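{- Let $G=(V,c,M)$ be a marked symmetric graph with $|M|$ even, and let $C$ be a basic minimum odd marked cut of $G$. Then there exists a minimum marked cut $C'$ of $G$ such that $C\supseteq C'$ or $C\cap C'=\emptyset$.
   Context: A marked symmetric graph is $G=(V,c,M)$ with $V$ finite, $c:V\times V\to\mathbb{Q}_{\ge0}$ symmetric ($c(u,v)=c(v,u)$), and $M\subseteq V$ the marked vertices. A cut is a subset $C\subseteq V$, with $\bar C=V\setminus C$ and value $\sum_{u\in C,v\in\bar C}c(u,v)$. A marked cut is a cut $C$ such that both $C$ and $\bar C$ contain a marked vertex. An odd marked cut (when $|M|$ is even) is a marked cut $C$ with $|C\cap M|$ odd. A minimum marked cut is a marked cut of minimum value among marked cuts. A minimum odd marked cut is an odd marked cut of minimum value among odd marked cuts. For a set $\mathcal{C}$ of cuts, $C\in\mathcal{C}$ is basic if no $C'\in\mathcal{C}$ with $C'\neq C$ satisfies $C'\subseteq C$. A basic minimum odd marked cut is a basic element of the set of minimum odd marked cuts. -}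

module Defs where

open import Data.Nat using (ℕ; _%_)
open import Data.Bool using (Bool; true; false; if_then_else_)
open import Data.Fin using (Fin)
open import Data.Fin.Subset using (Subset; _∈_; _⊆_; _∩_; ∁; ∣_∣; Nonempty; Empty)
open import Data.Vec using (lookup)
open import Data.List using (List; allFin; map; foldr)
open import Data.Rational using (ℚ; 0ℚ; _+_; _≤_)
open import Data.Product using (_×_; ∃)
open import Relation.Binary.PropositionalEquality using (_≡_; _≢_)

sumℚ : List ℚ → ℚ
sumℚ = foldr _+_ 0ℚ

record MarkedSymGraph (n : ℕ) : Set where
  field
    c      : Fin n → Fin n → ℚ
    c-nonneg : ∀ u v → 0ℚ ≤ c u v
    c-sym  : ∀ u v → c u v ≡ c v u
    M      : Subset n

open MarkedSymGraph public

Cut : ℕ → Set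
Cut n = Subset n

cutValue : ∀ {n} → MarkedSymGraph n → Cut n → ℚ
cutValue {n} G C =
  sumℚ (map (λ u → sumℚ (map (λ v →
      if lookup C u then (if lookup C v then 0ℚ else c G u v) else 0ℚ)
    (allFin n))) (allFin n))

IsMarkedCut : ∀ {n} → MarkedSymGraph n → Cut n → Set
IsMarkedCut G C = Nonempty (C ∩ M G) × Nonempty (∁ C ∩ M G)

IsOddMarkedCut : ∀ {n} → MarkedSymGraph n → Cut n → Set
IsOddMarkedCut G C = IsMarkedCut G C × (∣ C ∩ M G ∣ % 2 ≡ 1)

IsMinMarkedCut : ∀ {n} → MarkedSymGraph n → Cut n → Set
IsMinMarkedCut G C =
  IsMarkedCut G C × (∀ D → IsMarkedCut G D → cutValue G C ≤ cutValue G D)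

IsMinOddMarkedCut : ∀ {n} → MarkedSymGraph n → Cut n → Set
IsMinOddMarkedCut G C =
  IsOddMarkedCut G C × (∀ D → IsOddMarkedCut G D → cutValue G C ≤ cutValue G D)

IsBasicMinOddMarkedCut : ∀ {n} → MarkedSymGraph n → Cut n → Set
IsBasicMinOddMarkedCut G C =
  IsMinOddMarkedCut G C × (∀ D → IsMinOddMarkedCut G D → D ⊆ C → D ≡ C)

-- The cut function f is symmetric (f (∁ X) = f X) and submodular
-- (f (A ∩ B) + f (A ∪ B) ≤ f A + f B).  Take any minimum marked cut D, replaced
-- by its complement if necessary so that C ∩ D contains an odd number of marked
-- vertices.  If some marked vertex lies outside C ∪ D, then C ∩ D is an odd
-- marked cut, so f (C ∩ D) ≥ f C and submodularity gives f (C ∪ D) ≤ f D: the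
-- complement of C ∪ D is a minimum marked cut disjoint from C.  Otherwise
-- C ∪ ∁ D has the same marked vertices as C, hence is an odd marked cut, and
-- submodularity applied to C and ∁ D gives f (C ∩ ∁ D) ≤ f D: the minimum
-- marked cut C ∩ ∁ D is contained in C.
module Submission where

open import Defs
open import Algebra.Bundles using (CommutativeMonoid)
open import Data.Bool using (Bool; true; false; if_then_else_; _∧_; _∨_; not)
open import Data.Empty using (⊥-elim)
open import Data.Fin as Fin using (Fin)
open import Data.Fin.Subset using (Subset; _∈_; _⊆_; _∩_; _∪_; ∁; ∣_∣; Nonempty; Empty)
open import Data.Fin.Subset.Properties
  using (x∈p∩q⁺; x∈p∩q⁻; x∈p∪q⁺; x∈∁p⇒x∉p; x∉p⇒x∈∁p; p∩q⊆p; p∩q⊆q; p⊆p∪q; ⊆-refl;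
         p⊆q⇒∁p⊇∁q; drop-∷-Empty; Empty-unique; ∣⊥∣≡0; nonempty?; ∪-∩-booleanAlgebra)
open import Data.List using (List; []; _∷_; map; allFin; filter; _++_)
open import Data.List.Membership.Propositional using () renaming (_∈_ to _∈ₗ_)
open import Data.List.Membership.Propositional.Properties using (∈-map⁺; ∈-++⁺ˡ; ∈-++⁺ʳ; ∈-filter⁺)
import Data.List.Relation.Unary.All as All
open import Data.List.Relation.Unary.All.Properties using (all-filter)
open import Data.List.Relation.Unary.Any using (here)
open import Data.Nat as ℕ using (ℕ; zero; suc; _%_; s≤s)
open import Data.Nat.DivMod using (%-distribˡ-+; m%n%n≡m%n; m%n<n)
open import Data.Nat.Properties using (+-suc; 1+n≢0)
open import Data.Product using (Σ; _×_; _,_; proj₁; proj₂; map₂)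
open import Data.Rational using (ℚ; 0ℚ; _+_; _≤_)
open import Data.Rational.Properties
  using (≤-refl; ≤-trans; ≤-reflexive; _≤?_; ≰⇒>; <-irrefl; <-≤-trans; +-mono-≤;
         +-mono-≤-<; +-monoˡ-≤; +-monoʳ-≤; +-comm; +-identityˡ; +-0-commutativeMonoid;
         ≤-decTotalOrder; module ≤-Reasoning)
open import Data.Sum using (_⊎_; inj₁; inj₂; [_,_])
open import Data.Vec as Vec using ([]; _∷_; lookup)
open import Data.Vec.Properties using (lookup-zipWith; lookup-map)
open import Relation.Binary.Bundles using (DecTotalOrder)
open import Relation.Binary.PropositionalEquality
  using (_≡_; refl; sym; trans; cong; cong₂; subst; module ≡-Reasoning)
open import Relation.Nullary using (yes; no; ¬_)
open import Relation.Nullary.Decidable using (_×-dec_)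
open import Relation.Unary using (Decidable)

open import Algebra.Properties.CommutativeSemigroup
  (CommutativeMonoid.commutativeSemigroup +-0-commutativeMonoid) using (interchange)
open import Data.List.Extrema (DecTotalOrder.totalOrder ≤-decTotalOrder)
  using (argmin; f[argmin]≤f[xs]; argmin-all)

module _ {A : Set} where

  ∑ : List A → (A → ℚ) → ℚ
  ∑ xs f = sumℚ (map f xs)

  ∑-cong : ∀ xs {f g : A → ℚ} → (∀ x → f x ≡ g x) → ∑ xs f ≡ ∑ xs g
  ∑-cong []       f≡g = refl
  ∑-cong (x ∷ xs) f≡g = cong₂ _+_ (f≡g x) (∑-cong xs f≡g)

  ∑-mono-≤ : ∀ xs {f g : A → ℚ} → (∀ x → f x ≤ g x) → ∑ xs f ≤ ∑ xs g
  ∑-mono-≤ []       f≤g = ≤-refl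
  ∑-mono-≤ (x ∷ xs) f≤g = +-mono-≤ (f≤g x) (∑-mono-≤ xs f≤g)

  ∑-zero : ∀ xs → ∑ xs (λ _ → 0ℚ) ≡ 0ℚ
  ∑-zero []       = refl
  ∑-zero (x ∷ xs) = trans (cong (0ℚ +_) (∑-zero xs)) (+-identityˡ 0ℚ)

  ∑-distrib-+ : ∀ xs (f g : A → ℚ) → ∑ xs (λ x → f x + g x) ≡ ∑ xs f + ∑ xs g
  ∑-distrib-+ []       f g = sym (+-identityˡ 0ℚ)
  ∑-distrib-+ (x ∷ xs) f g =
    trans (cong (f x + g x +_) (∑-distrib-+ xs f g)) (interchange (f x) (g x) _ _)

∑-comm : ∀ {A B : Set} (xs : List A) (ys : List B) (h : A → B → ℚ) →
         ∑ xs (λ x → ∑ ys (h x)) ≡ ∑ ys (λ y → ∑ xs (λ x → h x y))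
∑-comm []       ys h = sym (∑-zero ys)
∑-comm (x ∷ xs) ys h = trans (cong (∑ ys (h x) +_) (∑-comm xs ys h))
  (sym (∑-distrib-+ ys (h x) (λ y → ∑ xs (λ x′ → h x′ y))))

x+y≤z+w∧z≤x⇒y≤w : ∀ {x y z w} → x + y ≤ z + w → z ≤ x → y ≤ w
x+y≤z+w∧z≤x⇒y≤w {y = y} {w = w} x+y≤z+w z≤x with y ≤? w
... | yes y≤w = y≤w
... | no  y≰w = ⊥-elim (<-irrefl refl (<-≤-trans (+-mono-≤-< z≤x (≰⇒> y≰w)) x+y≤z+w))

-- cutValue G X unfolds to the double sum over u, v of
-- crossingWeight (lookup X u) (lookup X v) (c G u v).
crossingWeight : Bool → Bool → ℚ → ℚ
crossingWeight a b x = if a then (if b then 0ℚ else x) else 0ℚ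

crossingWeight-submodular : ∀ a b a′ b′ {x} → 0ℚ ≤ x →
  crossingWeight (a ∧ b) (a′ ∧ b′) x + crossingWeight (a ∨ b) (a′ ∨ b′) x
    ≤ crossingWeight a a′ x + crossingWeight b b′ x
crossingWeight-submodular true  true  true  false {x} _   = ≤-reflexive (+-comm x 0ℚ)
crossingWeight-submodular true  false false true      0≤x = +-monoˡ-≤ 0ℚ 0≤x
crossingWeight-submodular true  false false false {x} _   = ≤-reflexive (+-comm 0ℚ x)
crossingWeight-submodular false true  true  false     0≤x = +-monoʳ-≤ 0ℚ 0≤x
crossingWeight-submodular true  true  true  true      _   = ≤-refl
crossingWeight-submodular true  true  false b′        _   = ≤-refl
crossingWeight-submodular true  false true  b′        _   = ≤-refl
crossingWeight-submodular false true  true  true      _   = ≤-refl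
crossingWeight-submodular false true  false true      _   = ≤-refl
crossingWeight-submodular false true  false false     _   = ≤-refl
crossingWeight-submodular false false a′    b′        _   = ≤-refl

crossingWeight-not : ∀ a b x → crossingWeight (not a) (not b) x ≡ crossingWeight b a x
crossingWeight-not true  true  x = refl
crossingWeight-not true  false x = refl
crossingWeight-not false true  x = refl
crossingWeight-not false false x = refl

module _ {n : ℕ} (G : MarkedSymGraph n) where

  private
    f : Cut n → ℚ
    f = cutValue G
    V : List (Fin n)
    V = allFin n

  cutValue-submodular : ∀ A B → f (A ∩ B) + f (A ∪ B) ≤ f A + f B
  cutValue-submodular A B = begin
      f (A ∩ B) + f (A ∪ B)
    ≡⟨ sym (∑-distrib-+ V _ _) ⟩
      ∑ V (λ u → ∑ V (weight (A ∩ B) u) + ∑ V (weight (A ∪ B) u))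
    ≡⟨ ∑-cong V (λ u → sym (∑-distrib-+ V _ _)) ⟩
      ∑ V (λ u → ∑ V (λ v → weight (A ∩ B) u v + weight (A ∪ B) u v))
    ≤⟨ ∑-mono-≤ V (λ u → ∑-mono-≤ V (edgewise u)) ⟩
      ∑ V (λ u → ∑ V (λ v → weight A u v + weight B u v))
    ≡⟨ ∑-cong V (λ u → ∑-distrib-+ V _ _) ⟩
      ∑ V (λ u → ∑ V (weight A u) + ∑ V (weight B u))
    ≡⟨ ∑-distrib-+ V _ _ ⟩
      f A + f B ∎
    where
    open ≤-Reasoning
    weight : Cut n → Fin n → Fin n → ℚ
    weight X u v = crossingWeight (lookup X u) (lookup X v) (c G u v)
    edgewise : ∀ u v → weight (A ∩ B) u v + weight (A ∪ B) u v ≤ weight A u v + weight B u v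
    edgewise u v
      rewrite lookup-zipWith _∧_ u A B | lookup-zipWith _∧_ v A B
            | lookup-zipWith _∨_ u A B | lookup-zipWith _∨_ v A B
      = crossingWeight-submodular (lookup A u) (lookup B u) (lookup A v) (lookup B v)
                                  (c-nonneg G u v)

  cutValue-∁ : ∀ X → f (∁ X) ≡ f X
  cutValue-∁ X = begin
      f (∁ X)
    ≡⟨ ∑-cong V (λ u → ∑-cong V (edgewise u)) ⟩
      ∑ V (λ u → ∑ V (λ v → crossingWeight (lookup X v) (lookup X u) (c G v u)))
    ≡⟨ ∑-comm V V (λ u v → crossingWeight (lookup X v) (lookup X u) (c G v u)) ⟩
      f X ∎
    where
    open ≡-Reasoning
    edgewise : ∀ u v → crossingWeight (lookup (∁ X) u) (lookup (∁ X) v) (c G u v)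
                     ≡ crossingWeight (lookup X v) (lookup X u) (c G v u)
    edgewise u v rewrite lookup-map u not X | lookup-map v not X | c-sym G u v =
      crossingWeight-not (lookup X u) (lookup X v) (c G v u)

∣p∩q∩r∣+∣p∩∁q∩r∣≡∣p∩r∣ : ∀ {n} (p q r : Subset n) →
  ∣ (p ∩ q) ∩ r ∣ ℕ.+ ∣ (p ∩ ∁ q) ∩ r ∣ ≡ ∣ p ∩ r ∣
∣p∩q∩r∣+∣p∩∁q∩r∣≡∣p∩r∣ []          []          []          = refl
∣p∩q∩r∣+∣p∩∁q∩r∣≡∣p∩r∣ (true ∷ p)  (true ∷ q)  (true ∷ r)  =
  cong suc (∣p∩q∩r∣+∣p∩∁q∩r∣≡∣p∩r∣ p q r)
∣p∩q∩r∣+∣p∩∁q∩r∣≡∣p∩r∣ (true ∷ p)  (false ∷ q) (true ∷ r)  =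
  trans (+-suc _ _) (cong suc (∣p∩q∩r∣+∣p∩∁q∩r∣≡∣p∩r∣ p q r))
∣p∩q∩r∣+∣p∩∁q∩r∣≡∣p∩r∣ (true ∷ p)  (true ∷ q)  (false ∷ r) = ∣p∩q∩r∣+∣p∩∁q∩r∣≡∣p∩r∣ p q r
∣p∩q∩r∣+∣p∩∁q∩r∣≡∣p∩r∣ (true ∷ p)  (false ∷ q) (false ∷ r) = ∣p∩q∩r∣+∣p∩∁q∩r∣≡∣p∩r∣ p q r
∣p∩q∩r∣+∣p∩∁q∩r∣≡∣p∩r∣ (false ∷ p) (_ ∷ q)     (_ ∷ r)     = ∣p∩q∩r∣+∣p∩∁q∩r∣≡∣p∩r∣ p q r

module _ {n : ℕ} {p q r : Subset n} where

  [p∪∁q]∩r≡p∩r : Empty (∁ (p ∪ q) ∩ r) → (p ∪ ∁ q) ∩ r ≡ p ∩ r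
  [p∪∁q]∩r≡p∩r = go p q r
    where
    go : ∀ {m} (p q r : Subset m) → Empty (∁ (p ∪ q) ∩ r) → (p ∪ ∁ q) ∩ r ≡ p ∩ r
    go []          []          []          _ = refl
    go (true ∷ p)  (_ ∷ q)     (s ∷ r)     e = cong (s ∷_) (go p q r (drop-∷-Empty e))
    go (false ∷ p) (true ∷ q)  (_ ∷ r)     e = cong (false ∷_) (go p q r (drop-∷-Empty e))
    go (false ∷ p) (false ∷ q) (false ∷ r) e = cong (false ∷_) (go p q r (drop-∷-Empty e))
    go (false ∷ p) (false ∷ q) (true ∷ r)  e = ⊥-elim (e (Fin.zero , Vec.here))

  [p∩∁q]∩r≡∁q∩r : Empty (∁ (p ∪ q) ∩ r) → (p ∩ ∁ q) ∩ r ≡ ∁ q ∩ r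
  [p∩∁q]∩r≡∁q∩r = go p q r
    where
    go : ∀ {m} (p q r : Subset m) → Empty (∁ (p ∪ q) ∩ r) → (p ∩ ∁ q) ∩ r ≡ ∁ q ∩ r
    go []          []          []          _ = refl
    go (true ∷ p)  (false ∷ q) (s ∷ r)     e = cong (s ∷_) (go p q r (drop-∷-Empty e))
    go (true ∷ p)  (true ∷ q)  (_ ∷ r)     e = cong (false ∷_) (go p q r (drop-∷-Empty e))
    go (false ∷ p) (true ∷ q)  (_ ∷ r)     e = cong (false ∷_) (go p q r (drop-∷-Empty e))
    go (false ∷ p) (false ∷ q) (false ∷ r) e = cong (false ∷_) (go p q r (drop-∷-Empty e))
    go (false ∷ p) (false ∷ q) (true ∷ r)  e = ⊥-elim (e (Fin.zero , Vec.here))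

∩-monoˡ-⊆ : ∀ {n} {p q r : Subset n} → p ⊆ q → p ∩ r ⊆ q ∩ r
∩-monoˡ-⊆ {p = p} {r = r} p⊆q x∈p∩r with x∈p∩q⁻ p r x∈p∩r
... | x∈p , x∈r = x∈p∩q⁺ (p⊆q x∈p , x∈r)

p∩∁[p∪q]-Empty : ∀ {n} (p q : Subset n) → Empty (p ∩ ∁ (p ∪ q))
p∩∁[p∪q]-Empty p q (x , x∈) with x∈p∩q⁻ p (∁ (p ∪ q)) x∈
... | x∈p , x∈∁[p∪q] = x∈∁p⇒x∉p x∈∁[p∪q] (x∈p∪q⁺ (inj₁ x∈p))

p∩r≡q∩r⇒∁p∩r⊆∁q∩r : ∀ {n} {p q r : Subset n} → p ∩ r ≡ q ∩ r → ∁ p ∩ r ⊆ ∁ q ∩ r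
p∩r≡q∩r⇒∁p∩r⊆∁q∩r {p = p} {q} {r} eq {x} x∈∁p∩r with x∈p∩q⁻ (∁ p) r x∈∁p∩r
... | x∈∁p , x∈r = x∈p∩q⁺ (x∉p⇒x∈∁p x∉q , x∈r)
  where
  x∉q : ¬ (x ∈ q)
  x∉q x∈q = x∈∁p⇒x∉p x∈∁p (proj₁ (x∈p∩q⁻ p r (subst (x ∈_) (sym eq) (x∈p∩q⁺ (x∈q , x∈r)))))

odd⇒Nonempty : ∀ {n} (p : Subset n) → ∣ p ∣ % 2 ≡ 1 → Nonempty p
odd⇒Nonempty {n} p odd with nonempty? p
... | yes p-nonempty = p-nonempty
... | no  p-empty    = ⊥-elim (1+n≢0 (trans (sym odd) ∣p∣%2≡0))
  where
  ∣p∣%2≡0 : ∣ p ∣ % 2 ≡ 0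
  ∣p∣%2≡0 = cong (_% 2) (trans (cong ∣_∣ (Empty-unique p-empty)) (∣⊥∣≡0 n))

odd-summand : ∀ a b → (a ℕ.+ b) % 2 ≡ 1 → a % 2 ≡ 1 ⊎ b % 2 ≡ 1
odd-summand a b odd with a % 2 in a%2≡ | m%n<n a 2
... | 1           | _                 = inj₁ refl
... | suc (suc _) | s≤s (s≤s ())
... | 0           | _                 = inj₂ (begin
  b % 2                 ≡⟨ m%n%n≡m%n b 2 ⟨
  (0 ℕ.+ b % 2) % 2     ≡⟨ cong (λ r → (r ℕ.+ b % 2) % 2) a%2≡ ⟨
  (a % 2 ℕ.+ b % 2) % 2 ≡⟨ %-distribˡ-+ a b 2 ⟨
  (a ℕ.+ b) % 2         ≡⟨ odd ⟩
  1                     ∎)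
  where open ≡-Reasoning

allSubsets : ∀ n → List (Subset n)
allSubsets zero    = [] ∷ []
allSubsets (suc n) = map (true ∷_) (allSubsets n) ++ map (false ∷_) (allSubsets n)

∈-allSubsets : ∀ {n} (p : Subset n) → p ∈ₗ allSubsets n
∈-allSubsets []          = here refl
∈-allSubsets (true ∷ p)  = ∈-++⁺ˡ (∈-map⁺ (true ∷_) (∈-allSubsets p))
∈-allSubsets (false ∷ p) = ∈-++⁺ʳ (map (true ∷_) (allSubsets _)) (∈-map⁺ (false ∷_) (∈-allSubsets p))

module _ {n : ℕ} (G : MarkedSymGraph n) where

  open import Algebra.Lattice.Properties.BooleanAlgebra (∪-∩-booleanAlgebra n) using (¬-involutive)

  private
    f : Cut n → ℚ
    f = cutValue G

  isMarkedCut? : Decidable (IsMarkedCut G)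
  isMarkedCut? X = nonempty? (X ∩ M G) ×-dec nonempty? (∁ X ∩ M G)

  minMarkedCut : ∀ {C} → IsMarkedCut G C → Σ (Cut n) (IsMinMarkedCut G)
  minMarkedCut {C} C-marked = D , argmin-all f C-marked (all-filter isMarkedCut? (allSubsets n)) , D-min
    where
    markedCuts : List (Cut n)
    markedCuts = filter isMarkedCut? (allSubsets n)
    D : Cut n
    D = argmin f C markedCuts
    D-min : ∀ X → IsMarkedCut G X → f D ≤ f X
    D-min X X-marked = All.lookup (f[argmin]≤f[xs] {f = f} C markedCuts)
                                  (∈-filter⁺ isMarkedCut? (∈-allSubsets X) X-marked)

  ∁-markedCut : ∀ {X} → IsMarkedCut G X → IsMarkedCut G (∁ X)
  ∁-markedCut {X} (inside , outside) =
    outside , subst (λ Y → Nonempty (Y ∩ M G)) (sym (¬-involutive X)) inside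

  ∁-minMarkedCut : ∀ {X} → IsMinMarkedCut G X → IsMinMarkedCut G (∁ X)
  ∁-minMarkedCut {X} (X-marked , X-min) =
    ∁-markedCut X-marked , λ Y Y-marked → subst (_≤ f Y) (sym (cutValue-∁ G X)) (X-min Y Y-marked)

  minMarkedCut-≤ : ∀ {D X} → IsMinMarkedCut G D → IsMarkedCut G X → f X ≤ f D → IsMinMarkedCut G X
  minMarkedCut-≤ (_ , D-min) X-marked fX≤fD = X-marked , λ Y Y-marked → ≤-trans fX≤fD (D-min Y Y-marked)

  markedCut-between : ∀ {A X B} → A ⊆ X → X ⊆ B →
    Nonempty (A ∩ M G) → Nonempty (∁ B ∩ M G) → IsMarkedCut G X
  markedCut-between A⊆X X⊆B (a , a∈) (b , b∈) =
    (a , ∩-monoˡ-⊆ A⊆X a∈) , (b , ∩-monoˡ-⊆ (p⊆q⇒∁p⊇∁q X⊆B) b∈)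

  oddMarkedCut-resp-∩M : ∀ {X Y} → X ∩ M G ≡ Y ∩ M G → IsOddMarkedCut G X → IsOddMarkedCut G Y
  oddMarkedCut-resp-∩M eq ((inside , outside) , odd) =
    (subst Nonempty eq inside , map₂ (p∩r≡q∩r⇒∁p∩r⊆∁q∩r eq) outside) , subst (λ Z → ∣ Z ∣ % 2 ≡ 1) eq odd

  uncross-outside : ∀ {C D} → IsMinOddMarkedCut G C → IsMinMarkedCut G D →
    ∣ (C ∩ D) ∩ M G ∣ % 2 ≡ 1 → Nonempty (∁ (C ∪ D) ∩ M G) → IsMinMarkedCut G (∁ (C ∪ D))
  uncross-outside {C} {D} ((C-marked , _) , C-min) D-min odd outside =
    ∁-minMarkedCut (minMarkedCut-≤ D-min C∪D-marked f[C∪D]≤f[D])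
    where
    C∩D-odd : IsOddMarkedCut G (C ∩ D)
    C∩D-odd = markedCut-between ⊆-refl (p∩q⊆p C D) (odd⇒Nonempty ((C ∩ D) ∩ M G) odd) (proj₂ C-marked)
            , odd
    C∪D-marked : IsMarkedCut G (C ∪ D)
    C∪D-marked = markedCut-between (p⊆p∪q D) ⊆-refl (proj₁ C-marked) outside
    f[C∪D]≤f[D] : f (C ∪ D) ≤ f D
    f[C∪D]≤f[D] = x+y≤z+w∧z≤x⇒y≤w (cutValue-submodular G C D) (C-min (C ∩ D) C∩D-odd)

  uncross-inside : ∀ {C D} → IsMinOddMarkedCut G C → IsMinMarkedCut G D →
    Empty (∁ (C ∪ D) ∩ M G) → IsMinMarkedCut G (C ∩ ∁ D)
  uncross-inside {C} {D} (C-odd , C-min) D-min no-outside =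
    minMarkedCut-≤ ∁D-min C∩∁D-marked f[C∩∁D]≤f[∁D]
    where
    ∁D-min : IsMinMarkedCut G (∁ D)
    ∁D-min = ∁-minMarkedCut D-min
    C∩∁D-marked : IsMarkedCut G (C ∩ ∁ D)
    C∩∁D-marked = markedCut-between ⊆-refl (p∩q⊆q C (∁ D))
      (subst Nonempty (sym ([p∩∁q]∩r≡∁q∩r no-outside)) (proj₁ (proj₁ ∁D-min))) (proj₂ (proj₁ ∁D-min))
    C∪∁D-odd : IsOddMarkedCut G (C ∪ ∁ D)
    C∪∁D-odd = oddMarkedCut-resp-∩M (sym ([p∪∁q]∩r≡p∩r no-outside)) C-odd
    f[C∩∁D]≤f[∁D] : f (C ∩ ∁ D) ≤ f (∁ D)
    f[C∩∁D]≤f[∁D] = x+y≤z+w∧z≤x⇒y≤w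
      (subst (_≤ f C + f (∁ D)) (+-comm (f (C ∩ ∁ D)) (f (C ∪ ∁ D))) (cutValue-submodular G C (∁ D)))
      (C-min (C ∪ ∁ D) C∪∁D-odd)

  uncross : ∀ {C D} → IsMinOddMarkedCut G C → IsMinMarkedCut G D → ∣ (C ∩ D) ∩ M G ∣ % 2 ≡ 1 →
    Σ (Cut n) λ C′ → IsMinMarkedCut G C′ × (C′ ⊆ C ⊎ Empty (C ∩ C′))
  uncross {C} {D} C-minOdd D-min odd with nonempty? (∁ (C ∪ D) ∩ M G)
  ... | yes outside    = ∁ (C ∪ D) , uncross-outside C-minOdd D-min odd outside , inj₂ (p∩∁[p∪q]-Empty C D)
  ... | no  no-outside = C ∩ ∁ D , uncross-inside C-minOdd D-min no-outside , inj₁ (p∩q⊆p C (∁ D))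

  oddMarkedCut-splits : ∀ {C} → IsOddMarkedCut G C → ∀ D →
    ∣ (C ∩ D) ∩ M G ∣ % 2 ≡ 1 ⊎ ∣ (C ∩ ∁ D) ∩ M G ∣ % 2 ≡ 1
  oddMarkedCut-splits {C} (_ , odd) D = odd-summand ∣ (C ∩ D) ∩ M G ∣ ∣ (C ∩ ∁ D) ∩ M G ∣
    (trans (cong (_% 2) (∣p∩q∩r∣+∣p∩∁q∩r∣≡∣p∩r∣ C D (M G))) odd)

mainTheorem7 : ∀ {n} (G : MarkedSymGraph n) → ∣ M G ∣ % 2 ≡ 0 →
    (C : Cut n) → IsBasicMinOddMarkedCut G C →
    Σ (Cut n) λ C′ → IsMinMarkedCut G C′ × (C′ ⊆ C ⊎ Empty (C ∩ C′))
mainTheorem7 {n} G _ C (C-minOdd@(C-odd , _) , _) =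
  [ uncross G C-minOdd D-min , uncross G C-minOdd (∁-minMarkedCut G D-min) ]
    (oddMarkedCut-splits G C-odd D)
  where
  D : Cut n
  D = proj₁ (minMarkedCut G (proj₁ C-odd))
  D-min : IsMinMarkedCut G D
  D-min = proj₂ (minMarkedCut G (proj₁ C-odd))
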